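{- Let $A$ be of affine type with positive imaginary root $\delta$, and let $c$ be a Coxeter element. Then $\nu_c(\delta)=\tfrac12x_c$, where $x_c=-\omega_c(\cdot,\delta)\in V^*$.
   Context: $A=[a_{ij}]$ is a symmetrizable Cartan matrix of affine type (positive semidefinite, not positive definite, every proper principal submatrix positive definite); $V$ has basis simple roots $\alpha_i$, co-roots $\alpha_i^\vee=d_i^{ -1}\alpha_i$, symmetric form $K(\alpha_i^\vee,\alpha_j)=a_{ij}$; $\delta$ is the positive imaginary root (imaginary roots are $k\delta$, $k\ne0$), so $K(\cdot,\delta)=0$. $V^*$ is the dual with pairing $\langle\cdot,\cdot\rangle$, fundamental weights $\rho_i$ ($\langle\rho_i,\alpha_j^\vee\rangle=\delta_{ij}$) and co-weights $\rho_i^\vee$ ($\langle\rho_i^\vee,\alpha_j\rangle=\delta_{ij}$). Number the simple reflections so that $c=s_1\cdots s_n$. $\omega_c$ is the bilinear form on $V$ with $\omega_c(\alpha_i^\vee,\alpha_j)=a_{ij}$ if $i>j$, $0$ if $i=j$, $-a_{ij}$ if $i<j$; $E_c$ the bilinear form with $E_c(\alpha_i^\vee,\alpha_j)=a_{ij}$ if $i>j$, $1$ if $i=j$, $0$ if $i<j$; $\omega_c(\cdot,\delta)$ denotes $v\mapsto\omega_c(v,\delta)$. For $\beta\in V$ let $I=\{i:\langle\rho_i^\vee,\beta\rangle<0\}$, $\beta_+=\sum_{i\notin I}\langle\rho_i^\vee,\beta\rangle\alpha_i$, and $\nu_c(\beta)=-\sum_{i\in I}\langle\rho_i^\vee,\beta\rangle\rho_i-\sum_{i\notin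 I}E_c(\alpha_i^\vee,\beta_+)\rho_i$. -}

module Defs where

open import Data.Nat as ℕ using (ℕ; zero; suc)
open import Data.Nat.Divisibility using (_∣_)
open import Data.Fin as Fin using (Fin; toℕ)
open import Data.Fin.Properties using (<-cmp)
open import Data.Bool using (Bool; true; false)
open import Data.Product using (Σ; _×_; ∃; _,_)
open import Data.Integer as ℤ using (ℤ; +_)
open import Data.Rational as ℚ using (ℚ; 0ℚ; 1ℚ; _*_; _+_; -_; _<_; _≤_)
open import Data.Rational.Properties using (_<?_)
open import Relation.Binary.Definitions using (Tri; tri<; tri≈; tri>)
open import Relation.Binary.PropositionalEquality using (_≡_; _≢_)
open import Relation.Nullary using (¬_; yes; no)

Matrix : ℕ → Set
Matrix n = Fin n → Fin n → ℤ

-- V: coordinates in the basis of simple roots α_i (over ℚ)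
V : ℕ → Set
V n = Fin n → ℚ

-- V*: a linear functional, recorded by its values on the simple roots α_j
V* : ℕ → Set
V* n = Fin n → ℚ

Σℚ : ∀ {n} → (Fin n → ℚ) → ℚ
Σℚ {zero}  f = 0ℚ
Σℚ {suc n} f = f Fin.zero + Σℚ (λ i → f (Fin.suc i))

⟦_⟧ : ℤ → ℚ
⟦ z ⟧ = ℚ._/_ z 1

IsCartanMatrix : ∀ {n} → Matrix n → Set
IsCartanMatrix {n} A =
  (∀ i → A i i ≡ + 2) ×
  (∀ i j → i ≢ j → A i j ℤ.≤ + 0) ×
  (∀ i j → A i j ≡ + 0 → A j i ≡ + 0)

-- d is a symmetrizer: d_i > 0 and d_i a_ij = d_j a_ji.
-- Co-roots are α_i^∨ = d_i⁻¹ α_i, so K(α_i^∨, α_j) = a_ij and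
-- K(α_i, α_j) = d_i a_ij.
IsSymmetrizer : ∀ {n} → Matrix n → (Fin n → ℚ) → Set
IsSymmetrizer A d =
  (∀ i → 0ℚ < d i) × (∀ i j → d i * ⟦ A i j ⟧ ≡ d j * ⟦ A j i ⟧)

-- the bilinear form on V determined by B(α_i^∨, α_j) = M i j,
-- i.e. B(α_i, α_j) = d_i M_ij, extended bilinearly
form : ∀ {n} → (Fin n → ℚ) → (Fin n → Fin n → ℚ) → V n → V n → ℚ
form d M u v = Σℚ (λ i → Σℚ (λ j → u i * v j * d i * M i j))

formCoroot : ∀ {n} → (Fin n → Fin n → ℚ) → Fin n → V n → ℚ
formCoroot M i v = Σℚ (λ j → M i j * v j)

K : ∀ {n} → Matrix n → (Fin n → ℚ) → V n → V n → ℚ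
K A d = form d (λ i j → ⟦ A i j ⟧)

Zero : ∀ {n} → V n → Set
Zero x = ∀ i → x i ≡ 0ℚ

PositiveDefinite : ∀ {n} → Matrix n → (Fin n → ℚ) → Set
PositiveDefinite A d = ∀ x → ¬ Zero x → 0ℚ < K A d x x

PositiveSemidefinite : ∀ {n} → Matrix n → (Fin n → ℚ) → Set
PositiveSemidefinite A d = ∀ x → 0ℚ ≤ K A d x x

-- every proper principal submatrix (indices J ⊊ {1..n}) is positive definite:
-- the form restricted to vectors supported on J is positive definite
ProperPrincipalPosDef : ∀ {n} → Matrix n → (Fin n → ℚ) → Set
ProperPrincipalPosDef {n} A d =
  ∀ (J : Fin n → Bool) → (∃ λ i → J i ≡ false) →
  ∀ x → (∀ i → J i ≡ false → x i ≡ 0ℚ) → ¬ Zero x → 0ℚ < K A d x x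

IsAffine : ∀ {n} → Matrix n → (Fin n → ℚ) → Set
IsAffine A d =
  IsCartanMatrix A × IsSymmetrizer A d ×
  PositiveSemidefinite A d × ¬ PositiveDefinite A d × ProperPrincipalPosDef A d

-- δ : the positive imaginary root, i.e. the primitive vector with positive
-- integer coordinates in the radical: K(α_i^∨, δ) = Σ_j a_ij δ_j = 0.
IsPosImagRoot : ∀ {n} → Matrix n → (Fin n → ℕ) → Set
IsPosImagRoot {n} A δ =
  (∀ i → 0 ℕ.< δ i) ×
  (∀ i → Σℚ (λ j → ⟦ A i j ⟧ * ⟦ + δ j ⟧) ≡ 0ℚ) ×
  (∀ m → (∀ i → m ∣ δ i) → m ≡ 1)

toV : ∀ {n} → (Fin n → ℕ) → V n
toV δ i = ⟦ + δ i ⟧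

-- ω_c and E_c for c = s_1 ⋯ s_n (order of Fin n)

ωEntry : ∀ {n} → Matrix n → Fin n → Fin n → ℚ
ωEntry A i j with <-cmp i j
... | tri< _ _ _ = - ⟦ A i j ⟧
... | tri≈ _ _ _ = 0ℚ
... | tri> _ _ _ = ⟦ A i j ⟧

EEntry : ∀ {n} → Matrix n → Fin n → Fin n → ℚ
EEntry A i j with <-cmp i j
... | tri< _ _ _ = 0ℚ
... | tri≈ _ _ _ = 1ℚ
... | tri> _ _ _ = ⟦ A i j ⟧

ω_c : ∀ {n} → Matrix n → (Fin n → ℚ) → V n → V n → ℚ
ω_c A d = form d (ωEntry A)

-- fundamental weight ρ_i : ⟨ρ_i, α_j^∨⟩ = δ_ij, so ⟨ρ_i, α_j⟩ = d_j δ_ij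
ρ : ∀ {n} → (Fin n → ℚ) → Fin n → V* n
ρ d i j with <-cmp i j
... | tri≈ _ _ _ = d j
... | _ = 0ℚ

-- ⟨ρ_i^∨, β⟩ = β_i (coordinate in the simple-root basis)
-- I = {i : β_i < 0}; β_+ = Σ_{i∉I} β_i α_i
β₊ : ∀ {n} → V n → V n
β₊ β i with β i <? 0ℚ
... | yes _ = 0ℚ
... | no  _ = β i

νTerm : ∀ {n} → Matrix n → (Fin n → ℚ) → V n → Fin n → V* n
νTerm A d β i with β i <? 0ℚ
... | yes _ = λ k → β i * ρ d i k
... | no  _ = λ k → formCoroot (EEntry A) i (β₊ β) * ρ d i k

ν_c : ∀ {n} → Matrix n → (Fin n → ℚ) → V n → V* n
ν_c A d β k = - Σℚ (λ i → νTerm A d β i k)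

α : ∀ {n} → Fin n → V n
α k j with <-cmp k j
... | tri≈ _ _ _ = 1ℚ
... | _ = 0ℚ

x_c : ∀ {n} → Matrix n → (Fin n → ℚ) → V n → V* n
x_c A d δ k = - ω_c A d (α k) δ

{-# OPTIONS --safe #-}
-- δ has non-negative coordinates, so I = ∅ and δ₊ = δ; hence ν_c(δ) takes the
-- value −d_k E_c(α_k^∨, δ) on α_k, while x_c takes −d_k ω_c(α_k^∨, δ). On a Cartan
-- matrix ω_c + K = 2 E_c entrywise, and K(α_k^∨, δ) = 0 because δ lies in the
-- radical of K, so ω_c(α_k^∨, δ) = 2 E_c(α_k^∨, δ).
module Submission where

open import Defs
open import Data.Nat using (ℕ; zero; suc)
open import Data.Fin using (Fin)
open import Data.Rational using (ℚ; ½; _*_)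
open import Relation.Binary.PropositionalEquality using (_≡_)

open import Data.Empty using (⊥-elim)
open import Data.Fin as Fin using ()
open import Data.Fin.Properties using (<-cmp; suc-injective)
open import Data.Integer using (+_)
open import Data.Product using (_,_)
open import Function using (_∘_)
open import Data.Rational using (0ℚ; 1ℚ; _+_; -_; _<_; _≤_)
open import Data.Rational.Properties
  using (_<?_; +-identityˡ; +-identityʳ; +-inverseˡ; *-zeroʳ; *-distribˡ-+; *-distribʳ-+;
         +-0-commutativeMonoid; <-irrefl; ≤-<-trans; nonNegative⁻¹; normalize-nonNeg)
open import Data.Rational.Solver using (module +-*-Solver)
open import Algebra.Bundles using (CommutativeMonoid)
open import Algebra.Properties.CommutativeSemigroup
  (CommutativeMonoid.commutativeSemigroup +-0-commutativeMonoid) using (interchange)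
open import Relation.Binary.Definitions using (tri<; tri≈; tri>)
open import Relation.Binary.PropositionalEquality
  using (refl; sym; trans; cong; cong₂; _≢_; module ≡-Reasoning)
open import Relation.Nullary using (yes; no; ¬_)

open ≡-Reasoning

Σℚ-cong : ∀ {n} {f g : Fin n → ℚ} → (∀ i → f i ≡ g i) → Σℚ f ≡ Σℚ g
Σℚ-cong {zero}  f≗g = refl
Σℚ-cong {suc n} f≗g = cong₂ _+_ (f≗g Fin.zero) (Σℚ-cong (λ i → f≗g (Fin.suc i)))

Σℚ-zero : ∀ {n} {f : Fin n → ℚ} → (∀ i → f i ≡ 0ℚ) → Σℚ f ≡ 0ℚ
Σℚ-zero {zero}  f≗0 = refl
Σℚ-zero {suc n} f≗0 = cong₂ _+_ (f≗0 Fin.zero) (Σℚ-zero (λ i → f≗0 (Fin.suc i)))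

Σℚ-distrib-+ : ∀ {n} (f g : Fin n → ℚ) → Σℚ (λ i → f i + g i) ≡ Σℚ f + Σℚ g
Σℚ-distrib-+ {zero}  f g = refl
Σℚ-distrib-+ {suc n} f g = trans
  (cong (_+_ (f Fin.zero + g Fin.zero)) (Σℚ-distrib-+ (λ i → f (Fin.suc i)) (λ i → g (Fin.suc i))))
  (interchange (f Fin.zero) (g Fin.zero) (Σℚ (λ i → f (Fin.suc i))) (Σℚ (λ i → g (Fin.suc i))))

*-distribˡ-Σℚ : ∀ {n} (c : ℚ) (f : Fin n → ℚ) → Σℚ (λ i → c * f i) ≡ c * Σℚ f
*-distribˡ-Σℚ {zero}  c f = sym (*-zeroʳ c)
*-distribˡ-Σℚ {suc n} c f = trans
  (cong (_+_ (c * f Fin.zero)) (*-distribˡ-Σℚ c (λ i → f (Fin.suc i))))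
  (sym (*-distribˡ-+ c (f Fin.zero) _))

Σℚ-single : ∀ {n} (f : Fin n → ℚ) k → (∀ i → i ≢ k → f i ≡ 0ℚ) → Σℚ f ≡ f k
Σℚ-single {suc n} f Fin.zero f≗0 = trans
  (cong (_+_ (f Fin.zero)) (Σℚ-zero (λ i → f≗0 (Fin.suc i) (λ ()))))
  (+-identityʳ _)
Σℚ-single {suc n} f (Fin.suc k) f≗0 = trans
  (cong₂ _+_ (f≗0 Fin.zero (λ ()))
             (Σℚ-single (λ i → f (Fin.suc i)) k (λ i i≢k → f≗0 (Fin.suc i) (i≢k ∘ suc-injective))))
  (+-identityˡ _)

formCoroot-+ : ∀ {n} (M N : Fin n → Fin n → ℚ) i (v : V n) →
  formCoroot (λ i j → M i j + N i j) i v ≡ formCoroot M i v + formCoroot N i v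
formCoroot-+ M N i v = trans
  (Σℚ-cong (λ j → *-distribʳ-+ (v j) (M i j) (N i j)))
  (Σℚ-distrib-+ (λ j → M i j * v j) (λ j → N i j * v j))

α-diagonal : ∀ {n} (k : Fin n) → α k k ≡ 1ℚ
α-diagonal k with <-cmp k k
... | tri< _ k≢k _ = ⊥-elim (k≢k refl)
... | tri≈ _ _ _   = refl
... | tri> _ k≢k _ = ⊥-elim (k≢k refl)

α-off-diagonal : ∀ {n} (k i : Fin n) → i ≢ k → α k i ≡ 0ℚ
α-off-diagonal k i i≢k with <-cmp k i
... | tri< _ _ _   = refl
... | tri≈ _ k≡i _ = ⊥-elim (i≢k (sym k≡i))
... | tri> _ _ _   = refl

ρ-diagonal : ∀ {n} (d : Fin n → ℚ) k → ρ d k k ≡ d k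
ρ-diagonal d k with <-cmp k k
... | tri< _ k≢k _ = ⊥-elim (k≢k refl)
... | tri≈ _ _ _   = refl
... | tri> _ k≢k _ = ⊥-elim (k≢k refl)

ρ-off-diagonal : ∀ {n} (d : Fin n → ℚ) i k → i ≢ k → ρ d i k ≡ 0ℚ
ρ-off-diagonal d i k i≢k with <-cmp i k
... | tri< _ _ _   = refl
... | tri≈ _ i≡k _ = ⊥-elim (i≢k i≡k)
... | tri> _ _ _   = refl

form-simpleRoot : ∀ {n} (d : Fin n → ℚ) (M : Fin n → Fin n → ℚ) k (v : V n) →
  form d M (α k) v ≡ d k * formCoroot M k v
form-simpleRoot d M k v = begin
    Σℚ (λ i → Σℚ (λ j → α k i * v j * d i * M i j))
  ≡⟨ Σℚ-single _ k (λ i i≢k → Σℚ-zero (λ j → vanish i j (α-off-diagonal k i i≢k))) ⟩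
    Σℚ (λ j → α k k * v j * d k * M k j)
  ≡⟨ Σℚ-cong (λ j → rearrange (v j) (d k) (M k j) (α-diagonal k)) ⟩
    Σℚ (λ j → d k * (M k j * v j))
  ≡⟨ *-distribˡ-Σℚ (d k) (λ j → M k j * v j) ⟩
    d k * formCoroot M k v
  ∎
  where
  open +-*-Solver using (solve; _:*_; _:=_; con)
  vanish : ∀ i j → α k i ≡ 0ℚ → α k i * v j * d i * M i j ≡ 0ℚ
  vanish i j eq rewrite eq = solve 3 (λ x y z → con 0ℚ :* x :* y :* z := con 0ℚ) refl (v j) (d i) (M i j)
  rearrange : ∀ x y z → α k k ≡ 1ℚ → α k k * x * y * z ≡ y * (z * x)
  rearrange x y z eq rewrite eq = solve 3 (λ x y z → con 1ℚ :* x :* y :* z := y :* (z :* x)) refl x y z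

-- Below the diagonal both sides are 2 a_ij, above it both vanish, and on it 0 + 2 = 2 · 1.
ωEntry+Cartan≡EEntry+EEntry : ∀ {n} (A : Matrix n) → (∀ i → A i i ≡ + 2) →
  ∀ i j → ωEntry A i j + ⟦ A i j ⟧ ≡ EEntry A i j + EEntry A i j
ωEntry+Cartan≡EEntry+EEntry A Aᵢᵢ≡2 i j with <-cmp i j
... | tri< _ _ _ = +-inverseˡ ⟦ A i j ⟧
... | tri> _ _ _ = refl
... | tri≈ _ refl _ rewrite Aᵢᵢ≡2 i = refl

ω-coroot-radical : ∀ {n} (A : Matrix n) → (∀ i → A i i ≡ + 2) → ∀ k (v : V n) →
  formCoroot (λ i j → ⟦ A i j ⟧) k v ≡ 0ℚ →
  formCoroot (ωEntry A) k v ≡ formCoroot (EEntry A) k v + formCoroot (EEntry A) k v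
ω-coroot-radical A Aᵢᵢ≡2 k v Kv≡0 = begin
    formCoroot (ωEntry A) k v
  ≡⟨ sym (+-identityʳ _) ⟩
    formCoroot (ωEntry A) k v + 0ℚ
  ≡⟨ cong (_+_ (formCoroot (ωEntry A) k v)) (sym Kv≡0) ⟩
    formCoroot (ωEntry A) k v + formCoroot (λ i j → ⟦ A i j ⟧) k v
  ≡⟨ sym (formCoroot-+ (ωEntry A) (λ i j → ⟦ A i j ⟧) k v) ⟩
    formCoroot (λ i j → ωEntry A i j + ⟦ A i j ⟧) k v
  ≡⟨ Σℚ-cong (λ j → cong (_* v j) (ωEntry+Cartan≡EEntry+EEntry A Aᵢᵢ≡2 k j)) ⟩
    formCoroot (λ i j → EEntry A i j + EEntry A i j) k v
  ≡⟨ formCoroot-+ (EEntry A) (EEntry A) k v ⟩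
    formCoroot (EEntry A) k v + formCoroot (EEntry A) k v
  ∎

x_c-simpleRoot : ∀ {n} (A : Matrix n) d (v : V n) k →
  x_c A d v k ≡ - (d k * formCoroot (ωEntry A) k v)
x_c-simpleRoot A d v k = cong -_ (form-simpleRoot d (ωEntry A) k v)

NonNegative : ∀ {n} → V n → Set
NonNegative β = ∀ i → 0ℚ ≤ β i

toV-nonNegative : ∀ {n} (δ : Fin n → ℕ) → NonNegative (toV δ)
toV-nonNegative δ i = nonNegative⁻¹ _ {{normalize-nonNeg (δ i) 1}}

≤⇒≮ : ∀ {p q : ℚ} → p ≤ q → ¬ (q < p)
≤⇒≮ p≤q q<p = <-irrefl refl (≤-<-trans p≤q q<p)

β₊-nonNegative : ∀ {n} {β : V n} → NonNegative β → ∀ i → β₊ β i ≡ β i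
β₊-nonNegative {β = β} β≥0 i with β i <? 0ℚ
... | yes βᵢ<0 = ⊥-elim (≤⇒≮ (β≥0 i) βᵢ<0)
... | no  _    = refl

νTerm-nonNegative : ∀ {n} (A : Matrix n) d {β : V n} → NonNegative β → ∀ i k →
  νTerm A d β i k ≡ formCoroot (EEntry A) i β * ρ d i k
νTerm-nonNegative A d {β} β≥0 i k with β i <? 0ℚ
... | yes βᵢ<0 = ⊥-elim (≤⇒≮ (β≥0 i) βᵢ<0)
... | no  _    = cong (_* ρ d i k) (Σℚ-cong (λ j → cong (EEntry A i j *_) (β₊-nonNegative β≥0 j)))

ν_c-nonNegative : ∀ {n} (A : Matrix n) d {β : V n} → NonNegative β → ∀ k →
  ν_c A d β k ≡ - (formCoroot (EEntry A) k β * d k)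
ν_c-nonNegative A d {β} β≥0 k = cong -_ (begin
    Σℚ (λ i → νTerm A d β i k)
  ≡⟨ Σℚ-cong (λ i → νTerm-nonNegative A d β≥0 i k) ⟩
    Σℚ (λ i → E i * ρ d i k)
  ≡⟨ Σℚ-single _ k (λ i i≢k → trans (cong (E i *_) (ρ-off-diagonal d i k i≢k)) (*-zeroʳ (E i))) ⟩
    E k * ρ d k k
  ≡⟨ cong (E k *_) (ρ-diagonal d k) ⟩
    E k * d k
  ∎)
  where
  E : Fin _ → ℚ
  E i = formCoroot (EEntry A) i β

lemma5p9 : ∀ (n : ℕ) (A : Matrix n) (d : Fin n → ℚ) (δ : Fin n → ℕ) →
    IsAffine A d → IsPosImagRoot A δ →
    ∀ (k : Fin n) → ν_c A d (toV δ) k ≡ ½ * x_c A d (toV δ) k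
lemma5p9 n A d δ ((Aᵢᵢ≡2 , _) , _) (_ , Kδ≡0 , _) k = begin
    ν_c A d (toV δ) k
  ≡⟨ ν_c-nonNegative A d (toV-nonNegative δ) k ⟩
    - (E * d k)
  ≡⟨ solve 2 (λ e c → :- (e :* c) := con ½ :* (:- (c :* (e :+ e)))) refl E (d k) ⟩
    ½ * - (d k * (E + E))
  ≡⟨ cong (λ t → ½ * - (d k * t)) (sym (ω-coroot-radical A Aᵢᵢ≡2 k (toV δ) (Kδ≡0 k))) ⟩
    ½ * - (d k * formCoroot (ωEntry A) k (toV δ))
  ≡⟨ cong (½ *_) (sym (x_c-simpleRoot A d (toV δ) k)) ⟩
    ½ * x_c A d (toV δ) k
  ∎
  where
  open +-*-Solver using (solve; _:+_; _:*_; :-_; _:=_; con)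
  E : ℚ
  E = formCoroot (EEntry A) k (toV δ)
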